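{- For every odd $r\ge 3$, $2^r\le \zeta_e(BF(r))\le \left\lceil \frac{r}{2}\right\rceil 2^{r-1}$.
   Context: The $r$-dimensional butterfly network $BF(r)$ has vertex set $\{[w;i] : w\in\{0,1\}^r,\ 0\le i\le r\}$, and $[w;i]$ is adjacent to $[w';j]$ iff $j=i+1$ and either $w=w'$ or $w$ and $w'$ differ precisely in the $j$-th bit. Forcing (closure) rule: for a graph $G=(V,E)$ and $T\subseteq V$, the closure $C_G(T)$ starts as $T$ and, as long as some vertex of $C_G(T)$ has exactly one neighbor not in $C_G(T)$, that neighbor is added. Edge-forcing set: a set $K$ of pairwise independent edges of $G$ such that, with $T$ the set of endpoints of edges of $K$, $C_G(T)=V$. $\zeta_e(G)$ is the minimum cardinality of an edge-forcing set of $G$. -}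

module Defs where

open import Data.Nat using (ℕ; zero; suc; _+_; _*_)
open import Data.Bool using (Bool)
open import Data.Fin using (Fin; toℕ)
open import Data.Vec using (Vec; lookup)
open import Data.Product using (Σ; _×_; _,_; proj₁; proj₂; ∃)
open import Data.Sum using (_⊎_)
open import Data.List using (List)
open import Data.List.Relation.Unary.All using (All)
open import Data.List.Relation.Unary.Any using (Any)
open import Data.List.Relation.Unary.AllPairs using (AllPairs)
open import Relation.Binary.PropositionalEquality using (_≡_; _≢_)

record Graph : Set₁ where
  field
    V   : Set
    Adj : V → V → Set
open Graph public

-- Closure C_G(T): the least set containing T and closed under the forcing rule
-- "if u ∈ C and every neighbour of u other than v lies in C, then v ∈ C"
-- (i.e. the result of repeatedly adding the unique outside neighbour).
data Closure (G : Graph) (T : V G → Set) : V G → Set where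
  base  : ∀ {v} → T v → Closure G T v
  force : ∀ {u v} → Closure G T u → Adj G u v →
          (∀ w → Adj G u w → w ≢ v → Closure G T w) → Closure G T v

Edge : Graph → Set
Edge G = V G × V G

Independent : (G : Graph) → Edge G → Edge G → Set
Independent G (a , b) (c , d) = a ≢ c × a ≢ d × b ≢ c × b ≢ d

Endpoints : (G : Graph) → List (Edge G) → V G → Set
Endpoints G K v = Any (λ e → v ≡ proj₁ e ⊎ v ≡ proj₂ e) K

-- K is an edge-forcing set: a list of edges of G, pairwise independent
-- (hence pairwise distinct, so |K| = length K), whose endpoint set has closure V.
IsEdgeForcingSet : (G : Graph) → List (Edge G) → Set
IsEdgeForcingSet G K =
  All (λ e → Adj G (proj₁ e) (proj₂ e)) K ×
  AllPairs (Independent G) K ×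
  (∀ v → Closure G (Endpoints G K) v)

BFVertex : ℕ → Set
BFVertex r = Vec Bool r × Fin (suc r)

-- w and w' differ precisely in bit k (k : Fin r is bit number toℕ k + 1)
DiffExactlyAt : ∀ {r} → Vec Bool r → Vec Bool r → Fin r → Set
DiffExactlyAt w w' k =
  (lookup w k ≢ lookup w' k) × (∀ m → m ≢ k → lookup w m ≡ lookup w' m)

BFArc : ∀ {r} → BFVertex r → BFVertex r → Set
BFArc {r} (w , i) (w' , j) =
  (toℕ j ≡ suc (toℕ i)) ×
  (w ≡ w' ⊎ Σ (Fin r) (λ k → (suc (toℕ k) ≡ toℕ j) × DiffExactlyAt w w' k))

BF : ℕ → Graph
BF r = record { V = BFVertex r ; Adj = λ u v → BFArc u v ⊎ BFArc v u }

{-# OPTIONS --safe #-}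

-- On level 0 the two vertices [b t ; 0] (b ∈ {0,1}) have the same
-- neighbours, and so do the two vertices [t b ; r] on level r.  The forcing rule can
-- never add the first vertex of such a twin pair, so each of these 2^r pairs already
-- contains an endpoint of the edge-forcing set.  For r ≥ 2 no two different pairs are
-- joined by an edge, hence they are hit by pairwise different edges.
--
-- Upper bound, r = 2m + 1.  Take every straight edge [w ; 2c] – [w ; 2c+1] whose word has
-- a 0 in the bit switched between these two levels: (m+1)·2^(2m) disjoint edges.
-- If [w ; 2c+1] is not an endpoint, it is the only neighbour of the endpoint [w' ; 2c]
-- (w' = w with that bit flipped) still missing once level 2c − 1 is closed; likewise
-- [w ; 2c] is the only missing neighbour of the endpoint [w' ; 2c+1] once level 2c + 2
-- is closed.  So the odd levels are closed bottom-up and then the even levels top-down.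

module Submission where

open import Defs
open import Data.Bool using (Bool; true; false; not)
open import Data.Bool.Properties using (not-involutive; not-¬; ¬-not)
open import Data.Empty using (⊥-elim)
open import Data.Fin using (Fin; zero; suc; toℕ; inject₁; fromℕ; _≟_; combine; remQuot; quotient)
open import Data.Fin.Induction using (<-weakInduction; >-weakInduction)
import Data.Fin.Properties as Fin
open import Data.Fin.Properties
  using (toℕ-injective; toℕ-inject₁; inject₁-injective; toℕ<n; toℕ-fromℕ; injective⇒≤;
         combine-remQuot; remQuot-combine; *↔×; 2↔Bool)
open import Data.List using (List; length; map; allFin)
open import Data.List.Properties using (length-map; length-tabulate)
open import Data.List.Membership.Propositional using (_∈_)
open import Data.List.Membership.Propositional.Properties using (∈-map⁺; ∈-allFin)
open import Data.List.Relation.Unary.All as All using (All; _∷_)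
import Data.List.Relation.Unary.All.Properties as All
open import Data.List.Relation.Unary.Any as Any using (here; there; index)
open import Data.List.Relation.Unary.AllPairs as AllPairs using (AllPairs)
import Data.List.Relation.Unary.AllPairs.Properties as AllPairs
open import Data.List.Relation.Unary.Unique.Propositional.Properties using (allFin⁺)
open import Data.Nat using (ℕ; zero; suc; _+_; _*_; _∸_; _/_; _^_; _≤_; _<_; s≤s; z≤n; ⌈_/2⌉)
open import Data.Nat.DivMod using (_%_; m≡m%n+[m/n]*n)
import Data.Nat.Properties as ℕ
open import Data.Product using (Σ; ∃; ∃-syntax; _×_; _,_; proj₁; proj₂; uncurry)
open import Data.Product.Function.NonDependent.Propositional using (_×-↔_)
open import Data.Sum as Sum using (_⊎_; inj₁; inj₂)
open import Data.Vec using (Vec; []; _∷_; _∷ʳ_; lookup; updateAt; tabulate; uncons; insertAt; removeAt)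
open import Data.Vec.Properties
  using (∷-injectiveʳ; ∷ʳ-injectiveˡ; lookup∘updateAt; lookup∘updateAt′; updateAt-updateAt-local;
         updateAt-id; tabulate∘lookup; tabulate-cong; insertAt-removeAt; removeAt-insertAt)
open import Function using (_∘_; id)
open import Function.Bundles using (_↔_; Inverse; Injection; mk↔ₛ′)
open import Function.Properties.Inverse using (↔-refl; ↔-trans; ↔⇒↣)
open import Relation.Binary.PropositionalEquality
  using (_≡_; _≢_; refl; sym; trans; cong; subst; module ≡-Reasoning)
open import Relation.Nullary using (¬_; yes; no)

private
  variable
    n : ℕ

NoSoleNeighbourIn : (G : Graph) → (V G → Set) → Set
NoSoleNeighbourIn G B = ∀ {u v} → B v → Adj G u v → ∃[ v' ] B v' × Adj G u v' × v' ≢ v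

SameOrAdjacent : (G : Graph) → V G → V G → Set
SameOrAdjacent G u v = u ≡ v ⊎ Adj G u v ⊎ Adj G v u

SameOrAdjacent-sym : ∀ G {u v} → SameOrAdjacent G u v → SameOrAdjacent G v u
SameOrAdjacent-sym G (inj₁ u≡v)       = inj₁ (sym u≡v)
SameOrAdjacent-sym G (inj₂ (inj₁ uv)) = inj₂ (inj₂ uv)
SameOrAdjacent-sym G (inj₂ (inj₂ vu)) = inj₂ (inj₁ vu)

closure-meets⇒seed-meets : ∀ {G T B} → NoSoleNeighbourIn G B →
                           ∀ {v} → Closure G T v → B v → ∃[ z ] B z × T z
closure-meets⇒seed-meets noSole (base t)            bv = _ , bv , t
closure-meets⇒seed-meets noSole (force _ uv others) bv with noSole bv uv
... | v' , bv' , uv' , v'≢v = closure-meets⇒seed-meets noSole (others v' uv' v'≢v) bv'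

sameIndex⇒SameOrAdjacent : ∀ {G K z z'} → All (λ e → Adj G (proj₁ e) (proj₂ e)) K →
                           (p : Endpoints G K z) (q : Endpoints G K z') → index p ≡ index q →
                           SameOrAdjacent G z z'
sameIndex⇒SameOrAdjacent _        (here (inj₁ refl)) (here (inj₁ refl)) _ = inj₁ refl
sameIndex⇒SameOrAdjacent (uv ∷ _) (here (inj₁ refl)) (here (inj₂ refl)) _ = inj₂ (inj₁ uv)
sameIndex⇒SameOrAdjacent (uv ∷ _) (here (inj₂ refl)) (here (inj₁ refl)) _ = inj₂ (inj₂ uv)
sameIndex⇒SameOrAdjacent _        (here (inj₂ refl)) (here (inj₂ refl)) _ = inj₁ refl
sameIndex⇒SameOrAdjacent (_ ∷ adjacent) (there p) (there q) e =
  sameIndex⇒SameOrAdjacent adjacent p q (Fin.suc-injective e)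

separatedClasses⇒≤ : ∀ {n G K} → IsEdgeForcingSet G K → (B : Fin n → V G → Set) →
                     (∀ i → NoSoleNeighbourIn G (B i)) → (∀ i → ∃ (B i)) →
                     (∀ {i j z z'} → B i z → B j z' → SameOrAdjacent G z z' → i ≡ j) →
                     n ≤ length K
separatedClasses⇒≤ {n} {G} {K} (adjacent , _ , closed) B noSole inhabited separated =
  injective⇒≤ edgeOf-injective
  where
  hit : ∀ i → ∃[ z ] B i z × Endpoints G K z
  hit i = closure-meets⇒seed-meets (noSole i) (closed _) (proj₂ (inhabited i))

  edgeOf : Fin n → Fin (length K)
  edgeOf i = index (proj₂ (proj₂ (hit i)))

  edgeOf-injective : ∀ {i j} → edgeOf i ≡ edgeOf j → i ≡ j
  edgeOf-injective {i} {j} e =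
    separated (proj₁ (proj₂ (hit i))) (proj₁ (proj₂ (hit j))) (sameIndex⇒SameOrAdjacent adjacent _ _ e)

toggle : Vec Bool n → Fin n → Vec Bool n
toggle w k = updateAt w k not

lookup-toggle : ∀ (w : Vec Bool n) k → lookup (toggle w k) k ≡ not (lookup w k)
lookup-toggle w k = lookup∘updateAt k w

lookup-toggle-true : ∀ (w : Vec Bool n) k → lookup w k ≡ true → lookup (toggle w k) k ≡ false
lookup-toggle-true w k bit = trans (lookup-toggle w k) (cong not bit)

toggle-involutive : ∀ (w : Vec Bool n) k → toggle (toggle w k) k ≡ w
toggle-involutive w k = trans (updateAt-updateAt-local k w (not-involutive _)) (updateAt-id k w)

toggle-≢ : ∀ (w : Vec Bool n) k → toggle w k ≢ w
toggle-≢ w k e = not-¬ refl (trans (sym (cong (λ x → lookup x k) e)) (lookup-toggle w k))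

toggle-last : ∀ (t : Vec Bool n) b → toggle (t ∷ʳ b) (fromℕ n) ≡ t ∷ʳ not b
toggle-last []      b = refl
toggle-last (x ∷ t) b = cong (x ∷_) (toggle-last t b)

toggle-diffExactlyAt : ∀ (w : Vec Bool n) k → DiffExactlyAt w (toggle w k) k
toggle-diffExactlyAt w k =
  (λ e → not-¬ refl (trans e (lookup-toggle w k))) ,
  (λ i i≢k → sym (lookup∘updateAt′ i k i≢k w))

diffExactlyAt⇒toggle : ∀ {w x : Vec Bool n} {k} → DiffExactlyAt w x k → x ≡ toggle w k
diffExactlyAt⇒toggle {w = w} {x} {k} (differ , agree) = begin
  x                               ≡⟨ tabulate∘lookup x ⟨
  tabulate (lookup x)             ≡⟨ tabulate-cong pointwise ⟩
  tabulate (lookup (toggle w k))  ≡⟨ tabulate∘lookup (toggle w k) ⟩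
  toggle w k                      ∎
  where
  open ≡-Reasoning
  pointwise : ∀ i → lookup x i ≡ lookup (toggle w k) i
  pointwise i with i ≟ k
  ... | yes refl = trans (¬-not (differ ∘ sym)) (sym (lookup-toggle w k))
  ... | no i≢k   = trans (sym (agree i i≢k)) (sym (lookup∘updateAt′ i k i≢k w))

∷↔ : ∀ {A : Set} → (A × Vec A n) ↔ Vec A (suc n)
∷↔ = mk↔ₛ′ (uncurry _∷_) uncons (λ { (x ∷ xs) → refl }) (λ _ → refl)

2^↔Vec : ∀ n → Fin (2 ^ n) ↔ Vec Bool n
2^↔Vec zero    = mk↔ₛ′ (λ _ → []) (λ _ → zero) (λ { [] → refl }) (λ { zero → refl })
2^↔Vec (suc n) = ↔-trans *↔× (↔-trans (2↔Bool ×-↔ 2^↔Vec n) ∷↔)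

module _ {r : ℕ} where

  -- The edge between levels k and k + 1 switches bit k (bit k + 1 in the paper's numbering).
  data Up : BFVertex r → BFVertex r → Set where
    straight : ∀ w k → Up (w , inject₁ k) (w , suc k)
    cross    : ∀ w k → Up (w , inject₁ k) (toggle w k , suc k)

  cross˘ : ∀ w k → Up (toggle w k , inject₁ k) (w , suc k)
  cross˘ w k =
    subst (λ x → Up (toggle w k , inject₁ k) (x , suc k)) (toggle-involutive w k) (cross (toggle w k) k)

  Up⇒BFArc : ∀ {u v : BFVertex r} → Up u v → BFArc u v
  Up⇒BFArc (straight w k) = cong suc (sym (toℕ-inject₁ k)) , inj₁ refl
  Up⇒BFArc (cross w k)    = cong suc (sym (toℕ-inject₁ k)) , inj₂ (k , refl , toggle-diffExactlyAt w k)

  BFArc⇒Up : ∀ {u v : BFVertex r} → BFArc u v → Up u v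
  BFArc⇒Up {u = w , i} {x , suc k} (level , bits)
    with toℕ-injective (trans (toℕ-inject₁ k) (ℕ.suc-injective level))
  ... | refl with bits
  ...   | inj₁ refl = straight w k
  ...   | inj₂ (k' , bit , diff)
          with toℕ-injective {i = k'} {j = k} (ℕ.suc-injective bit) | diffExactlyAt⇒toggle {w = w} {x} diff
  ...     | refl | refl = cross w k

  Adj⇒Up : ∀ {u v : BFVertex r} → Adj (BF r) u v → Up u v ⊎ Up v u
  Adj⇒Up = Sum.map BFArc⇒Up BFArc⇒Up

  Up⇒Adj : ∀ {u v : BFVertex r} → Up u v → Adj (BF r) u v
  Up⇒Adj = inj₁ ∘ Up⇒BFArc

  Up⇒Adj˘ : ∀ {u v : BFVertex r} → Up u v → Adj (BF r) v u
  Up⇒Adj˘ = inj₂ ∘ Up⇒BFArc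

  Up-level : ∀ {u v : BFVertex r} → Up u v → toℕ (proj₂ v) ≡ suc (toℕ (proj₂ u))
  Up-level = proj₁ ∘ Up⇒BFArc

  Adj-level : ∀ {u v : BFVertex r} → Adj (BF r) u v →
              toℕ (proj₂ v) ≡ suc (toℕ (proj₂ u)) ⊎ toℕ (proj₂ u) ≡ suc (toℕ (proj₂ v))
  Adj-level = Sum.map proj₁ proj₁

  Up-from : ∀ {w k v} → Up (w , inject₁ k) v → v ≡ (w , suc k) ⊎ v ≡ (toggle w k , suc k)
  Up-from {k = k} up = view up refl
    where
    view : ∀ {u v} → Up u v → proj₂ u ≡ inject₁ k →
           v ≡ (proj₁ u , suc k) ⊎ v ≡ (toggle (proj₁ u) k , suc k)
    view (straight w _) e with inject₁-injective e
    ... | refl = inj₁ refl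
    view (cross w _) e with inject₁-injective e
    ... | refl = inj₂ refl

  Up-to : ∀ {w k v} → Up v (w , suc k) → v ≡ (w , inject₁ k) ⊎ v ≡ (toggle w k , inject₁ k)
  Up-to (straight w k) = inj₁ refl
  Up-to (cross w k)    = inj₂ (cong (_, inject₁ k) (sym (toggle-involutive w k)))

  no-Up-from-top : ∀ {w v} → ¬ Up (w , fromℕ r) v
  no-Up-from-top {v = _ , l} up = ℕ.<-irrefl (trans (Up-level up) (cong suc (toℕ-fromℕ r))) (toℕ<n l)

  Adj⇒level≢ : ∀ {u v : BFVertex r} → Adj (BF r) u v → proj₂ u ≢ proj₂ v
  Adj⇒level≢ adj refl = Sum.[ ℕ.1+n≢n ∘ sym , ℕ.1+n≢n ∘ sym ] (Adj-level adj)

  sameLevel⇒≡ : ∀ {u v : BFVertex r} → proj₂ u ≡ proj₂ v → SameOrAdjacent (BF r) u v → u ≡ v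
  sameLevel⇒≡ _     (inj₁ u≡v)        = u≡v
  sameLevel⇒≡ level (inj₂ (inj₁ adj)) = ⊥-elim (Adj⇒level≢ adj level)
  sameLevel⇒≡ level (inj₂ (inj₂ adj)) = ⊥-elim (Adj⇒level≢ adj (sym level))

module _ {n : ℕ} where

  BottomPair : Vec Bool n → BFVertex (suc n) → Set
  BottomPair t v = ∃[ b ] v ≡ (b ∷ t , zero)

  TopPair : Vec Bool n → BFVertex (suc n) → Set
  TopPair t v = ∃[ b ] v ≡ (t ∷ʳ b , fromℕ (suc n))

  BottomPair-noSoleNeighbour : ∀ t → NoSoleNeighbourIn (BF (suc n)) (BottomPair t)
  BottomPair-noSoleNeighbour t {u} (b , refl) adj with Adj⇒Up adj
  ... | inj₁ ()
  ... | inj₂ up = twin , (not b , refl) , Up⇒Adj˘ (twin-below (Up-from {k = zero} up)) ,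
                  toggle-≢ (b ∷ t) zero ∘ cong proj₁
    where
    twin : BFVertex (suc n)
    twin = (not b ∷ t , zero)
    twin-below : u ≡ (b ∷ t , suc zero) ⊎ u ≡ (not b ∷ t , suc zero) → Up twin u
    twin-below (inj₁ refl) = cross˘ (b ∷ t) zero
    twin-below (inj₂ refl) = straight (not b ∷ t) zero

  TopPair-noSoleNeighbour : ∀ t → NoSoleNeighbourIn (BF (suc n)) (TopPair t)
  TopPair-noSoleNeighbour t {u} (b , refl) adj with Adj⇒Up adj
  ... | inj₂ up = ⊥-elim (no-Up-from-top up)
  ... | inj₁ up = twin , (not b , cong (_, fromℕ (suc n)) (toggle-last t b)) ,
                  Up⇒Adj (twin-above (Up-to up)) , toggle-≢ w (fromℕ n) ∘ cong proj₁
    where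
    w : Vec Bool (suc n)
    w = t ∷ʳ b
    twin : BFVertex (suc n)
    twin = (toggle w (fromℕ n) , fromℕ (suc n))
    twin-above : u ≡ (w , inject₁ (fromℕ n)) ⊎ u ≡ (toggle w (fromℕ n) , inject₁ (fromℕ n)) →
                 Up u twin
    twin-above (inj₁ refl) = cross w (fromℕ n)
    twin-above (inj₂ refl) = straight (toggle w (fromℕ n)) (fromℕ n)

  TwinPair : Vec Bool (suc n) → BFVertex (suc n) → Set
  TwinPair (false ∷ t) = BottomPair t
  TwinPair (true  ∷ t) = TopPair t

  TwinPair-noSoleNeighbour : ∀ w → NoSoleNeighbourIn (BF (suc n)) (TwinPair w)
  TwinPair-noSoleNeighbour (false ∷ t) = BottomPair-noSoleNeighbour t
  TwinPair-noSoleNeighbour (true  ∷ t) = TopPair-noSoleNeighbour t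

  TwinPair-inhabited : ∀ w → ∃ (TwinPair w)
  TwinPair-inhabited (false ∷ t) = _ , false , refl
  TwinPair-inhabited (true  ∷ t) = _ , false , refl

bottom-top-apart : ∀ {w w'} → ¬ SameOrAdjacent (BF (suc (suc n))) (w , zero) (w' , fromℕ (suc (suc n)))
bottom-top-apart (inj₁ ())
bottom-top-apart (inj₂ (inj₁ adj)) with Adj-level adj
... | inj₁ ()
... | inj₂ ()
bottom-top-apart (inj₂ (inj₂ adj)) with Adj-level adj
... | inj₁ ()
... | inj₂ ()

TwinPair-separated : ∀ w w' {v v'} → TwinPair w v → TwinPair w' v' →
                     SameOrAdjacent (BF (suc (suc n))) v v' → w ≡ w'
TwinPair-separated (false ∷ t) (false ∷ t') (_ , refl) (_ , refl) link =
  cong (false ∷_) (∷-injectiveʳ (cong proj₁ (sameLevel⇒≡ refl link)))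
TwinPair-separated (true ∷ t) (true ∷ t') (_ , refl) (_ , refl) link =
  cong (true ∷_) (∷ʳ-injectiveˡ t t' (cong proj₁ (sameLevel⇒≡ refl link)))
TwinPair-separated (false ∷ t) (true ∷ t') (_ , refl) (_ , refl) link = ⊥-elim (bottom-top-apart link)
TwinPair-separated (true ∷ t) (false ∷ t') (_ , refl) (_ , refl) link =
  ⊥-elim (bottom-top-apart (SameOrAdjacent-sym (BF _) link))

BF-lowerBound : ∀ {r} → 2 ≤ r → (K : List (Edge (BF r))) → IsEdgeForcingSet (BF r) K →
                2 ^ r ≤ length K
BF-lowerBound {suc (suc n)} (s≤s (s≤s z≤n)) K forcing =
  separatedClasses⇒≤ forcing (TwinPair ∘ to) (TwinPair-noSoleNeighbour ∘ to) (TwinPair-inhabited ∘ to)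
    (λ {i} {j} p q link → injective (TwinPair-separated (to i) (to j) p q link))
  where open Injection (↔⇒↣ (2^↔Vec (suc (suc n))))

module _ {r : ℕ} (T : BFVertex r → Set) where

  RungsAt : Fin r → Set
  RungsAt k = ∀ w → lookup w k ≡ false → T (w , inject₁ k) × T (w , suc k)

  Layer : ℕ → Set
  Layer l = ∀ w (i : Fin (suc r)) → toℕ i ≡ l → Closure (BF r) T (w , i)

  level⇒Layer : ∀ {i} → (∀ w → Closure (BF r) T (w , i)) → Layer (toℕ i)
  level⇒Layer closed w _ e rewrite toℕ-injective e = closed w

  Layer-empty : ∀ {l} → r < l → Layer l
  Layer-empty r<l w i refl = ⊥-elim (ℕ.<⇒≱ r<l (ℕ.≤-pred (toℕ<n i)))

  upper-Layer : ∀ {k} → RungsAt k → (∀ l → toℕ k ≡ suc l → Layer l) → Layer (suc (toℕ k))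
  upper-Layer {k} rungsAt below = level⇒Layer {suc k} closed
    where
    closed : ∀ w → Closure (BF r) T (w , suc k)
    closed w with lookup w k in bit
    ... | false = base (proj₂ (rungsAt w bit))
    ... | true  = force (base (proj₁ (rungsAt (toggle w k) toggled))) (Up⇒Adj (cross˘ w k)) others
      where
      toggled : lookup (toggle w k) k ≡ false
      toggled = lookup-toggle-true w k bit
      others : ∀ v → Adj (BF r) (toggle w k , inject₁ k) v → v ≢ (w , suc k) → Closure (BF r) T v
      others (x , i) adj v≢ with Adj⇒Up adj
      ... | inj₂ up = below (toℕ i) (trans (sym (toℕ-inject₁ k)) (Up-level up)) x i refl
      ... | inj₁ up with Up-from up
      ...   | inj₁ refl = base (proj₂ (rungsAt (toggle w k) toggled))
      ...   | inj₂ refl = ⊥-elim (v≢ (cong (_, suc k) (toggle-involutive w k)))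

  lower-Layer : ∀ {k} → RungsAt k → Layer (suc (suc (toℕ k))) → Layer (toℕ k)
  lower-Layer {k} rungsAt above = subst Layer (toℕ-inject₁ k) (level⇒Layer {inject₁ k} closed)
    where
    closed : ∀ w → Closure (BF r) T (w , inject₁ k)
    closed w with lookup w k in bit
    ... | false = base (proj₁ (rungsAt w bit))
    ... | true  = force (base (proj₂ (rungsAt (toggle w k) toggled))) (Up⇒Adj˘ (cross w k)) others
      where
      toggled : lookup (toggle w k) k ≡ false
      toggled = lookup-toggle-true w k bit
      others : ∀ v → Adj (BF r) (toggle w k , suc k) v → v ≢ (w , inject₁ k) → Closure (BF r) T v
      others (x , i) adj v≢ with Adj⇒Up adj
      ... | inj₁ up = above x i (Up-level up)
      ... | inj₂ up with Up-to up
      ...   | inj₁ refl = base (proj₁ (rungsAt (toggle w k) toggled))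
      ...   | inj₂ refl = ⊥-elim (v≢ (cong (_, inject₁ k) (toggle-involutive w k)))

evenBit : ∀ {m} → Fin (suc m) → Fin (suc (m * 2))
evenBit zero            = zero
evenBit {suc m} (suc c) = suc (suc (evenBit c))

toℕ-evenBit : ∀ {m} (c : Fin (suc m)) → toℕ (evenBit c) ≡ toℕ c * 2
toℕ-evenBit zero            = refl
toℕ-evenBit {suc m} (suc c) = cong (λ x → suc (suc x)) (toℕ-evenBit c)

toℕ-evenBit-suc : ∀ {m} (c : Fin m) → toℕ (evenBit (suc c)) ≡ suc (suc (toℕ (evenBit (inject₁ c))))
toℕ-evenBit-suc c = begin
  toℕ (evenBit (suc c))                   ≡⟨ toℕ-evenBit (suc c) ⟩
  suc (suc (toℕ c * 2))                   ≡⟨ cong (λ x → suc (suc (x * 2))) (toℕ-inject₁ c) ⟨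
  suc (suc (toℕ (inject₁ c) * 2))         ≡⟨ cong (λ x → suc (suc x)) (toℕ-evenBit (inject₁ c)) ⟨
  suc (suc (toℕ (evenBit (inject₁ c))))   ∎
  where open ≡-Reasoning

inject₁-evenBit : ∀ {m} (c : Fin (suc m)) → inject₁ (evenBit c) ≡ combine c zero
inject₁-evenBit zero            = refl
inject₁-evenBit {suc m} (suc c) = cong (λ x → suc (suc x)) (inject₁-evenBit c)

suc-evenBit : ∀ {m} (c : Fin (suc m)) → suc (evenBit c) ≡ combine c (suc zero)
suc-evenBit zero            = refl
suc-evenBit {suc m} (suc c) = cong (λ x → suc (suc x)) (suc-evenBit c)

module _ {m : ℕ} {T : BFVertex (suc (m * 2)) → Set}
         (rungsAtEvenBits : ∀ c → RungsAt T (evenBit {m} c)) where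

  odd-Layer : ∀ c → Layer T (suc (toℕ (evenBit {m} c)))
  odd-Layer = <-weakInduction (λ c → Layer T (suc (toℕ (evenBit {m} c))))
    (upper-Layer T {evenBit {m} zero} (rungsAtEvenBits zero) (λ _ ()))
    λ c below → upper-Layer T {evenBit (suc c)} (rungsAtEvenBits (suc c)) λ l e →
      subst (Layer T) (ℕ.suc-injective (trans (sym (toℕ-evenBit-suc c)) e)) below

  even-Layer : ∀ c → Layer T (toℕ (evenBit {m} c))
  even-Layer = >-weakInduction (λ c → Layer T (toℕ (evenBit {m} c)))
    (lower-Layer T {evenBit (fromℕ m)} (rungsAtEvenBits (fromℕ m)) (Layer-empty T beyond-top))
    λ c above → lower-Layer T {evenBit (inject₁ c)} (rungsAtEvenBits (inject₁ c))
                  (subst (Layer T) (toℕ-evenBit-suc c) above)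
    where
    beyond-top : suc (m * 2) < suc (suc (toℕ (evenBit (fromℕ m))))
    beyond-top =
      s≤s (s≤s (ℕ.≤-reflexive (sym (trans (toℕ-evenBit (fromℕ m)) (cong (_* 2) (toℕ-fromℕ m))))))

  rungsAtEvenBits⇒closure : ∀ v → Closure (BF (suc (m * 2))) T v
  rungsAtEvenBits⇒closure (w , l) =
    subst (λ l → Closure (BF (suc (m * 2))) T (w , l)) (combine-remQuot {suc m} 2 l) (at (remQuot {suc m} 2 l))
    where
    at : ∀ (cj : Fin (suc m) × Fin 2) → Closure (BF (suc (m * 2))) T (w , uncurry combine cj)
    at (c , zero)     = even-Layer c w _ (trans (cong toℕ (sym (inject₁-evenBit c))) (toℕ-inject₁ _))
    at (c , suc zero) = odd-Layer c w _ (cong toℕ (sym (suc-evenBit c)))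

⌈1+m*2/2⌉≡1+m : ∀ m → ⌈ suc (m * 2) /2⌉ ≡ suc m
⌈1+m*2/2⌉≡1+m zero    = refl
⌈1+m*2/2⌉≡1+m (suc m) = cong suc (⌈1+m*2/2⌉≡1+m m)

module _ (m : ℕ) where

  -- A rung at an even bit is named by that bit and the remaining 2m bits of its word.
  Rung : Set
  Rung = Fin (suc m) × Vec Bool (m * 2)

  rung : Rung → Edge (BF (suc (m * 2)))
  rung (c , u) = (w , inject₁ (evenBit c)) , (w , suc (evenBit c))
    where
    w : Vec Bool (suc (m * 2))
    w = insertAt u (evenBit c) false

  rungOf : BFVertex (suc (m * 2)) → Rung
  rungOf (w , l) = quotient {suc m} 2 l , removeAt w (evenBit (quotient {suc m} 2 l))

  rungOf-insertAt : ∀ {c l} u → quotient {suc m} 2 l ≡ c →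
                    rungOf (insertAt u (evenBit c) false , l) ≡ (c , u)
  rungOf-insertAt {l = l} u refl = cong (_ ,_) (removeAt-insertAt u (evenBit (quotient {suc m} 2 l)) false)

  rungOf-rung₁ : ∀ t → rungOf (proj₁ (rung t)) ≡ t
  rungOf-rung₁ (c , u) = rungOf-insertAt {l = inject₁ (evenBit c)} u
    (trans (cong (quotient 2) (inject₁-evenBit c)) (cong proj₁ (remQuot-combine c zero)))

  rungOf-rung₂ : ∀ t → rungOf (proj₂ (rung t)) ≡ t
  rungOf-rung₂ (c , u) = rungOf-insertAt {l = suc (evenBit c)} u
    (trans (cong (quotient 2) (suc-evenBit c)) (cong proj₁ (remQuot-combine c (suc zero))))

  rung-independent : ∀ {t t'} → t ≢ t' → Independent (BF (suc (m * 2))) (rung t) (rung t')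
  rung-independent {t} {t'} t≢t' =
    apart (rungOf-rung₁ t) (rungOf-rung₁ t') , apart (rungOf-rung₁ t) (rungOf-rung₂ t') ,
    apart (rungOf-rung₂ t) (rungOf-rung₁ t') , apart (rungOf-rung₂ t) (rungOf-rung₂ t')
    where
    apart : ∀ {v v'} → rungOf v ≡ t → rungOf v' ≡ t' → v ≢ v'
    apart v↦t v'↦t' v≡v' = t≢t' (trans (sym v↦t) (trans (cong rungOf v≡v') v'↦t'))

  Rung↔ : Fin (suc m * 2 ^ (m * 2)) ↔ Rung
  Rung↔ = ↔-trans *↔× (↔-refl ×-↔ 2^↔Vec (m * 2))

  open Inverse Rung↔ using (to; from; strictlyInverseˡ)

  rungs : List (Edge (BF (suc (m * 2))))
  rungs = map (rung ∘ to) (allFin _)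

  rung∈rungs : ∀ t → rung t ∈ rungs
  rung∈rungs t =
    subst (λ t → rung t ∈ rungs) (strictlyInverseˡ t) (∈-map⁺ (rung ∘ to) (∈-allFin (from t)))

  rungs-rungsAtEvenBits : ∀ c → RungsAt (Endpoints (BF (suc (m * 2))) rungs) (evenBit c)
  rungs-rungsAtEvenBits c w bit =
    subst (λ x → Endpoint (x , inject₁ k) × Endpoint (x , suc k))
      restored
      (Any.map (inj₁ ∘ cong proj₁) (rung∈rungs (c , removeAt w k)) ,
       Any.map (inj₂ ∘ cong proj₂) (rung∈rungs (c , removeAt w k)))
    where
    Endpoint : BFVertex (suc (m * 2)) → Set
    Endpoint = Endpoints (BF (suc (m * 2))) rungs
    k : Fin (suc (m * 2))
    k = evenBit c
    restored : insertAt (removeAt w k) k false ≡ w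
    restored = trans (cong (insertAt (removeAt w k) k) (sym bit)) (insertAt-removeAt w k)

  BF-upperBound : Σ (List (Edge (BF (suc (m * 2))))) λ K →
                  IsEdgeForcingSet (BF (suc (m * 2))) K × length K ≤ ⌈ suc (m * 2) /2⌉ * 2 ^ (m * 2)
  BF-upperBound =
    rungs , (adjacent , independent , rungsAtEvenBits⇒closure rungs-rungsAtEvenBits) , ℕ.≤-reflexive size
    where
    adjacent : All (λ e → Adj (BF (suc (m * 2))) (proj₁ e) (proj₂ e)) rungs
    adjacent = All.map⁺ (All.universal (λ _ → Up⇒Adj (straight _ _)) _)

    independent : AllPairs (Independent (BF (suc (m * 2)))) rungs
    independent =
      AllPairs.map⁺ (AllPairs.map (λ i≢j → rung-independent (i≢j ∘ injective)) (allFin⁺ _))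
      where open Injection (↔⇒↣ Rung↔) using (injective)

    size : length rungs ≡ ⌈ suc (m * 2) /2⌉ * 2 ^ (m * 2)
    size = begin
      length rungs                           ≡⟨ length-map (rung ∘ to) (allFin _) ⟩
      length (allFin (suc m * 2 ^ (m * 2)))  ≡⟨ length-tabulate id ⟩
      suc m * 2 ^ (m * 2)                    ≡⟨ cong (_* 2 ^ (m * 2)) (⌈1+m*2/2⌉≡1+m m) ⟨
      ⌈ suc (m * 2) /2⌉ * 2 ^ (m * 2)        ∎
      where open ≡-Reasoning

odd⇒≡1+m*2 : ∀ r → r % 2 ≡ 1 → ∃[ m ] r ≡ suc (m * 2)
odd⇒≡1+m*2 r odd = r / 2 , trans (m≡m%n+[m/n]*n r 2) (cong (_+ r / 2 * 2) odd)

theorem4p9 : (r : ℕ) → r % 2 ≡ 1 → 3 ≤ r →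
    ((K : List (Edge (BF r))) → IsEdgeForcingSet (BF r) K → 2 ^ r ≤ length K) ×
    Σ (List (Edge (BF r))) (λ K → IsEdgeForcingSet (BF r) K × length K ≤ ⌈ r /2⌉ * 2 ^ (r ∸ 1))
theorem4p9 r odd 3≤r with odd⇒≡1+m*2 r odd
... | m , refl = BF-lowerBound (ℕ.≤-trans (ℕ.n≤1+n 2) 3≤r) , BF-upperBound m
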